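{- Let $m$ and $n$ be positive integers and let $\tau_o(K_{m,n})$ denote the number of odd spanning trees of the complete bipartite graph $K_{m,n}$. Then $$\tau_o(K_{m,n})=\frac{1}{2^{m+n}}\left[\sum_{i=0}^{m}\binom{m}{i}(2i-m)^{n-1}\right]\left[\sum_{j=0}^{n}\binom{n}{j}(2j-n)^{m-1}\right].$$
   Context: $K_{m,n}$ is the complete bipartite graph whose two parts have $m$ and $n$ labelled vertices. An odd spanning tree of a graph $G$ is a spanning tree $T$ of $G$ in which every vertex has odd degree in $T$; spanning trees are counted as subgraphs of the labelled graph. The convention $0^0=1$ is used. -}

module Defs where

open import Data.Nat as ℕ using (ℕ; zero; suc; _≤_; _%_)
open import Data.Nat.Combinatorics using (_C_)
open import Data.Integer as ℤ using (ℤ; +_)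
open import Data.Bool using (Bool; true; false)
open import Data.Fin using (Fin)
open import Data.Vec using (Vec; lookup; map; foldr)
open import Data.Vec.Base using (tabulate)
open import Data.List as List using (List; []; _∷_; _++_; length; upTo)
open import Data.List.Relation.Unary.Unique.Propositional using (Unique)
open import Data.List.Relation.Unary.Linked using (Linked)
open import Data.Sum using (_⊎_; inj₁; inj₂)
open import Data.Product using (Σ; _×_)
open import Relation.Binary.PropositionalEquality using (_≡_)

Vertex : ℕ → ℕ → Set
Vertex m n = Fin m ⊎ Fin n

-- A (spanning) subgraph of the labelled graph K_{m,n} is a set of its edges;
-- edge {i,j} (i on the left, j on the right) is present iff S[i][j] = true.
Subgraph : ℕ → ℕ → Set
Subgraph m n = Vec (Vec Bool n) m

data Adj {m n : ℕ} (S : Subgraph m n) : Vertex m n → Vertex m n → Set where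
  lr : ∀ i j → lookup (lookup S i) j ≡ true → Adj S (inj₁ i) (inj₂ j)
  rl : ∀ i j → lookup (lookup S i) j ≡ true → Adj S (inj₂ j) (inj₁ i)

data Walk {m n : ℕ} (S : Subgraph m n) : Vertex m n → Vertex m n → Set where
  []  : ∀ {u} → Walk S u u
  _∷_ : ∀ {u w v} → Adj S u w → Walk S w v → Walk S u v

Connected : {m n : ℕ} → Subgraph m n → Set
Connected S = ∀ u v → Walk S u v

HasCycle : {m n : ℕ} → Subgraph m n → Set
HasCycle {m} {n} S =
  Σ (Vertex m n) λ u → Σ (List (Vertex m n)) λ rest →
    (2 ≤ length rest) × Unique (u ∷ rest) × Linked (Adj S) (u ∷ rest ++ u ∷ [])

Acyclic : {m n : ℕ} → Subgraph m n → Set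
Acyclic S = HasCycle S → Data.Empty.⊥
  where import Data.Empty

IsSpanningTree : {m n : ℕ} → Subgraph m n → Set
IsSpanningTree S = Connected S × Acyclic S

boolToℕ : Bool → ℕ
boolToℕ true  = 1
boolToℕ false = 0

sumVec : {k : ℕ} → Vec ℕ k → ℕ
sumVec = foldr _ ℕ._+_ 0

degree : {m n : ℕ} → Subgraph m n → Vertex m n → ℕ
degree S (inj₁ i) = sumVec (map boolToℕ (lookup S i))
degree S (inj₂ j) = sumVec (map (λ row → boolToℕ (lookup row j)) S)

Odd : ℕ → Set
Odd d = d % 2 ≡ 1

IsOddSpanningTree : {m n : ℕ} → Subgraph m n → Set
IsOddSpanningTree {m} {n} S = IsSpanningTree S × (∀ (v : Vertex m n) → Odd (degree S v))

-- ∑_{i=0}^{m} C(m,i) (2i - m)^e  (in ℤ; ℤ._^_ satisfies x^0 = 1, so 0^0 = 1)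
sumℤ : List ℤ → ℤ
sumℤ = List.foldr ℤ._+_ (+ 0)

binomSum : ℕ → ℕ → ℤ
binomSum m e = sumℤ (List.map (λ i → (+ (m C i)) ℤ.* ((+ (2 ℕ.* i) ℤ.- + m) ℤ.^ e)) (upTo (suc m)))

{-# OPTIONS --safe #-}

-- Deleting from a spanning tree of K_{a+1,b+1} its first left leaf (or, if it has none, its
-- first right leaf) and recording the neighbour of that leaf gives a Prüfer-type bijection
-- between spanning trees and pairs of words (f , g) ∈ [a+1]^b × [b+1]^a in which every vertex
-- occurs deg − 1 times; the deleted leaf is the first letter missing from f (or from g), so the
-- tree can be rebuilt from the code. Odd spanning trees therefore correspond to pairs of words
-- in which every letter occurs an even number of times.
--
-- Let N_p(k) count the words in [m]^k whose letter multiplicities have parities p ∈ (ℤ/2)^m.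
-- Then N_p(k+1) = Σ_x N_{p+e_x}(k), and the character sums 2^{-m} Σ_s (Σ_x s_x)^k Π_{p_x = 1} s_x
-- over s ∈ {±1}^m obey the same recursion (multiply by Σ_x s_x) with the same initial values
-- (orthogonality of characters). Grouping the s by their number i of entries +1 turns the
-- sum for p = 0 into 2^m N_0(k) = Σ_i C(m,i) (2i − m)^k.

module Submission where

open import Defs
open import Algebra.Properties.Semiring.Sum as SemiringSum using ()
open import Data.Bool using (Bool; true; false; not; _xor_; T; if_then_else_)
import Data.Bool.Properties as BoolP
open import Data.Empty using (⊥; ⊥-elim)
open import Data.Fin as Fin using (Fin; zero; suc; punchIn; punchOut; toℕ)
import Data.Fin.Properties as FinP
open import Data.Fin.Properties using (_≟_)
open import Data.Integer as ℤ using (ℤ; +_; _*_; _^_)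
import Data.Integer.Properties as ℤP
open import Data.Integer.Tactic.RingSolver using (solve-∀)
open import Algebra.Properties.CommutativeSemigroup ℤP.+-commutativeSemigroup
  using () renaming (interchange to ℤ+-interchange; x∙yz≈y∙xz to ℤ+-x∙yz≈y∙xz)
open import Data.List as List using (List; []; _∷_; _++_; length; filter)
import Data.List.Properties as ListP
open import Data.List.Membership.Propositional using (_∈_; _∉_)
open import Data.List.Membership.Propositional.Properties
  using (∈-map⁺; ∈-map⁻; ∈-cartesianProduct⁺; ∈-cartesianProduct⁻; ∈-cartesianProductWith⁺; ∈-allFin;
         ∈-filter⁺; ∈-filter⁻; ∈-∃++; ∈-lookup)
open import Data.List.Relation.Unary.All using ([]; _∷_)
import Data.List.Relation.Unary.All.Properties as AllP
open import Data.List.Relation.Unary.Any using (here; there; any?)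
open import Data.List.Relation.Unary.AllPairs using ([]; _∷_)
open import Data.List.Relation.Unary.Linked as Linked using (Linked; []; [-]; _∷_)
import Data.List.Relation.Unary.Linked.Properties as LinkedP
open import Data.List.Relation.Unary.Unique.Propositional using (Unique)
import Data.List.Relation.Unary.Unique.Propositional.Properties as UniqueP
open import Data.Maybe as Maybe using (Maybe; just; nothing)
open import Data.Nat as ℕ using (ℕ; zero; suc; _+_; _≤_; _<_; _∸_; z≤n; s≤s; _≡ᵇ_; _%_)
import Data.Nat.Properties as ℕP
open import Data.Nat.Combinatorics using (_C_; k>n⇒nCk≡0; nCk+nC[k+1]≡[n+1]C[k+1])
import Data.Nat.DivMod as DivModP
open import Data.Product using (Σ; ∃; _×_; _,_; proj₂)
open import Data.Product.Properties using (,-injectiveˡ; ,-injectiveʳ)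
open import Data.Sum using (_⊎_; inj₁; inj₂; swap)
open import Data.Sum.Properties using (swap-involutive; inj₁-injective; inj₂-injective; ≡-dec)
open import Data.Vec as Vec using (Vec; []; _∷_; lookup; tabulate; insertAt; removeAt)
import Data.Vec.Properties as VecP
open import Function using (_∘_; id; _⟨_⟩_; case_of_)
open import Function.Bundles using (_⇔_; mk⇔; Equivalence)
open import Relation.Nullary using (¬_; Dec; yes; no; does)
open import Relation.Unary using (Decidable; _≐_)
open import Relation.Nullary.Decidable using (dec-true; dec-false; does-≡; map′)
open import Relation.Binary.PropositionalEquality

private
  variable
    k l l′ m n : ℕ

module ℕΣ = SemiringSum ℕP.+-*-semiring
module ℤΣ = SemiringSum ℤP.+-*-semiring

δ : Fin n → Fin n → ℕ
δ x y = boolToℕ (does (x ≟ y))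

≟-true⇒≡ : {x y : Fin n} → does (x ≟ y) ≡ true → x ≡ y
≟-true⇒≡ {x = x} {y} eq with x ≟ y
... | yes x≡y = x≡y

δ-refl : (x : Fin n) → δ x x ≡ 1
δ-refl x = cong boolToℕ (dec-true (x ≟ x) refl)

∑-δ : (y : Fin n) → ℕΣ.sum (λ x → δ x y) ≡ 1
∑-δ {suc n} zero    = cong suc (ℕΣ.sum-replicate-zero n)
∑-δ {suc n} (suc y) = ∑-δ y

occ : Fin m → Vec (Fin m) k → ℕ
occ x []      = 0
occ x (y ∷ v) = δ x y + occ x v

∑-occ : (v : Vec (Fin m) k) → ℕΣ.sum (λ x → occ x v) ≡ k
∑-occ {m} []      = ℕΣ.sum-replicate-zero m
∑-occ     (y ∷ v) = begin
  ℕΣ.sum (λ x → δ x y + occ x v)                ≡⟨ ℕΣ.∑-distrib-+ (λ x → δ x y) (λ x → occ x v) ⟩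
  ℕΣ.sum (λ x → δ x y) + ℕΣ.sum (λ x → occ x v)  ≡⟨ cong₂ _+_ (∑-δ y) (∑-occ v) ⟩
  suc _                                          ∎
  where open ≡-Reasoning

occ-∷≡0 : {x y : Fin m} (v : Vec (Fin m) k) → occ x (y ∷ v) ≡ 0 → x ≢ y × occ x v ≡ 0
occ-∷≡0 {x = x} v eq =
  (λ { refl → ℕP.1+n≢0 (cong (λ d → d + occ x v) (sym (δ-refl x)) ⟨ trans ⟩ eq) }) , ℕP.m+n≡0⇒n≡0 _ eq

≤-sum-nonzero : (h : Fin n → ℕ) → (∀ x → h x ≢ 0) → n ≤ ℕΣ.sum h
≤-sum-nonzero {zero}  h h≢0 = z≤n
≤-sum-nonzero {suc n} h h≢0 with h zero in eq
... | zero  = ⊥-elim (h≢0 zero eq)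
... | suc c = s≤s (ℕP.≤-trans (≤-sum-nonzero (h ∘ suc) (h≢0 ∘ suc)) (ℕP.m≤n+m _ c))

all-occur⇒≤ : (v : Vec (Fin m) k) → (∀ x → occ x v ≢ 0) → m ≤ k
all-occur⇒≤ v occ≢0 = subst (_ ≤_) (∑-occ v) (≤-sum-nonzero (λ x → occ x v) occ≢0)

module _ {A : Set} where

  length-∷ʳ : (xs : List A) (x : A) → length (xs ++ x ∷ []) ≡ suc (length xs)
  length-∷ʳ xs x = ListP.length-++ xs ⟨ trans ⟩ ℕP.+-comm (length xs) 1

  unique-∷ʳ : {xs : List A} {x : A} → Unique xs → x ∉ xs → Unique (xs ++ x ∷ [])
  unique-∷ʳ uniq x∉xs = UniqueP.++⁺ uniq ([] ∷ []) λ { (x∈xs , here refl) → x∉xs x∈xs }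

  unique-++⁻ˡ : ∀ xs {ys : List A} → Unique (xs ++ ys) → Unique xs
  unique-++⁻ˡ []       _           = []
  unique-++⁻ˡ (x ∷ xs) (x∉ ∷ uniq) = AllP.++⁻ˡ xs x∉ ∷ unique-++⁻ˡ xs uniq

  module _ {R : A → A → Set} where

    linked-∷ʳ : ∀ xs {y z} → Linked R (xs ++ y ∷ []) → R y z → Linked R (xs ++ y ∷ z ∷ [])
    linked-∷ʳ []           [-]        r = r ∷ [-]
    linked-∷ʳ (x ∷ [])     (r′ ∷ [-]) r = r′ ∷ r ∷ [-]
    linked-∷ʳ (x ∷ y ∷ xs) (r′ ∷ l)   r = r′ ∷ linked-∷ʳ (y ∷ xs) l r

    linked-++⁻ˡ : ∀ xs {ys} → Linked R (xs ++ ys) → Linked R xs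
    linked-++⁻ˡ []           l       = []
    linked-++⁻ˡ (x ∷ [])     l       = [-]
    linked-++⁻ˡ (x ∷ y ∷ xs) (r ∷ l) = r ∷ linked-++⁻ˡ (y ∷ xs) l

    linked-last : ∀ x ys {w} → Linked R (x ∷ ys ++ w ∷ []) → ∃ λ z → z ∈ x ∷ ys × R z w
    linked-last x []       (r ∷ _) = x , here refl , r
    linked-last x (y ∷ ys) (_ ∷ l) with z , z∈ , r ← linked-last y ys l = z , there z∈ , r

  lookup-injective : {xs : List A} → Unique xs → ∀ p q → List.lookup xs p ≡ List.lookup xs q → p ≡ q
  lookup-injective {x ∷ xs} _          zero    zero    _  = refl
  lookup-injective {x ∷ xs} (x∉ ∷ _)   zero    (suc q) eq =
    ⊥-elim (AllP.All¬⇒¬Any x∉ (subst (_∈ xs) (sym eq) (∈-lookup q)))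
  lookup-injective {x ∷ xs} (x∉ ∷ _)   (suc p) zero    eq =
    ⊥-elim (AllP.All¬⇒¬Any x∉ (subst (_∈ xs) eq (∈-lookup p)))
  lookup-injective {x ∷ xs} (_ ∷ uniq) (suc p) (suc q) eq = cong suc (lookup-injective uniq p q eq)

-- Subgraphs of K_{m,n}: transposition and cycles

edge : Subgraph m n → Fin m → Fin n → Bool
edge S i j = lookup (lookup S i) j

lookup-ext : {A : Set} {u v : Vec A n} → (∀ i → lookup u i ≡ lookup v i) → u ≡ v
lookup-ext {u = u} {v} eq =
  sym (VecP.tabulate∘lookup u) ⟨ trans ⟩ VecP.tabulate-cong eq ⟨ trans ⟩ VecP.tabulate∘lookup v

subgraph-ext : {S S′ : Subgraph m n} → (∀ i j → edge S i j ≡ edge S′ i j) → S ≡ S′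
subgraph-ext eq = lookup-ext (λ i → lookup-ext (eq i))

transpose : Subgraph m n → Subgraph n m
transpose S = tabulate λ j → tabulate λ i → edge S i j

edge-transpose : (S : Subgraph m n) (j : Fin n) (i : Fin m) → edge (transpose S) j i ≡ edge S i j
edge-transpose S j i rewrite VecP.lookup∘tabulate (λ j → tabulate λ i → edge S i j) j =
  VecP.lookup∘tabulate (λ i → edge S i j) i

transpose-involutive : (S : Subgraph m n) → transpose (transpose S) ≡ S
transpose-involutive S = subgraph-ext λ i j → edge-transpose (transpose S) i j ⟨ trans ⟩ edge-transpose S j i

transpose-injective : {S S′ : Subgraph m n} → transpose S ≡ transpose S′ → S ≡ S′
transpose-injective {S = S} {S′} eq =
  sym (transpose-involutive S) ⟨ trans ⟩ cong transpose eq ⟨ trans ⟩ transpose-involutive S′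

module _ {S : Subgraph m n} where

  adj-sym : ∀ {u v} → Adj S u v → Adj S v u
  adj-sym (lr i j e) = rl i j e
  adj-sym (rl i j e) = lr i j e

  adj⇒≢ : ∀ {u v} → Adj S u v → u ≢ v
  adj⇒≢ (lr i j e) ()
  adj⇒≢ (rl i j e) ()

  adj-transpose : ∀ {u v} → Adj S u v → Adj (transpose S) (swap u) (swap v)
  adj-transpose (lr i j e) = rl j i (edge-transpose S j i ⟨ trans ⟩ e)
  adj-transpose (rl i j e) = lr j i (edge-transpose S j i ⟨ trans ⟩ e)

  adj-transpose⁻ : ∀ {u v} → Adj (transpose S) u v → Adj S (swap u) (swap v)
  adj-transpose⁻ (lr j i e) = rl i j (sym (edge-transpose S j i) ⟨ trans ⟩ e)
  adj-transpose⁻ (rl j i e) = lr i j (sym (edge-transpose S j i) ⟨ trans ⟩ e)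

  _++ʷ_ : ∀ {u v w} → Walk S u v → Walk S v w → Walk S u w
  []      ++ʷ q = q
  (a ∷ p) ++ʷ q = a ∷ (p ++ʷ q)

swap-injective : {u v : Vertex m n} → swap u ≡ swap v → u ≡ v
swap-injective {u = inj₁ _} {inj₁ _} refl = refl
swap-injective {u = inj₂ _} {inj₂ _} refl = refl

_≟ᵛ_ : (u v : Vertex m n) → Dec (u ≡ v)
_≟ᵛ_ = ≡-dec _≟_ _≟_

sumVec-map : {A : Set} (h : A → ℕ) (v : Vec A k) → sumVec (Vec.map h v) ≡ ℕΣ.sum (h ∘ lookup v)
sumVec-map h []      = refl
sumVec-map h (x ∷ v) = cong (λ s → h x + s) (sumVec-map h v)

degree-transpose : (S : Subgraph m n) (v : Vertex n m) → degree (transpose S) v ≡ degree S (swap v)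
degree-transpose {m} {n} S (inj₁ j) =
  sumVec-map boolToℕ (lookup (transpose S) j) ⟨ trans ⟩
  ℕΣ.sum-cong-≗ (λ i → cong boolToℕ (edge-transpose S j i)) ⟨ trans ⟩
  sym (sumVec-map _ S)
degree-transpose {m} {n} S (inj₂ i) =
  sumVec-map _ (transpose S) ⟨ trans ⟩
  ℕΣ.sum-cong-≗ (λ j → cong boolToℕ (edge-transpose S j i)) ⟨ trans ⟩
  sym (sumVec-map boolToℕ (lookup S i))

CycleAt : Subgraph m n → Vertex m n → List (Vertex m n) → Set
CycleAt S u rest = (2 ≤ length rest) × Unique (u ∷ rest) × Linked (Adj S) (u ∷ rest ++ u ∷ [])

module _ {S : Subgraph m n} where

  rotate₁ : ∀ {u a r} → CycleAt S u (a ∷ r) → CycleAt S a (r ++ u ∷ [])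
  rotate₁ {u} {a} {r} (len , u∉ ∷ uniq , lk) =
    subst (2 ≤_) (sym (length-∷ʳ r u)) len ,
    unique-∷ʳ uniq (AllP.All¬⇒¬Any u∉) ,
    subst (λ xs → Linked (Adj S) (a ∷ xs)) (sym (ListP.++-assoc r (u ∷ []) (a ∷ [])))
      (linked-∷ʳ (a ∷ r) (Linked.tail lk) (Linked.head lk))

  rotate : ∀ y ys x zs → CycleAt S y (ys ++ x ∷ zs) → CycleAt S x (zs ++ y ∷ ys)
  rotate y []        x zs cyc = rotate₁ cyc
  rotate y (y′ ∷ ys) x zs cyc =
    subst (CycleAt S x) (ListP.++-assoc zs (y ∷ []) (y′ ∷ ys))
      (rotate y′ ys x (zs ++ y ∷ []) (subst (CycleAt S y′) (ListP.++-assoc ys (x ∷ zs) (y ∷ [])) (rotate₁ cyc)))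

  cycle-through : ∀ {u rest x} → CycleAt S u rest → x ∈ u ∷ rest → ∃ (CycleAt S x)
  cycle-through {rest = rest} cyc (here refl) = rest , cyc
  cycle-through {u} cyc (there x∈rest) with ys , zs , refl ← ∈-∃++ x∈rest = zs ++ u ∷ ys , rotate u ys _ zs cyc

  pendant-not-on-cycle : ∀ {v c} → (∀ {w} → Adj S v w → w ≡ c) → ∀ {rest} → ¬ CycleAt S v rest
  pendant-not-on-cycle _   {_ ∷ []} (s≤s () , _)
  pendant-not-on-cycle v⇒c {r₁ ∷ r₂ ∷ rs} (_ , _ ∷ (r₁∉ ∷ _) , lk)
    with z , z∈ , z~v ← linked-last r₂ rs (Linked.tail (Linked.tail lk)) =
    AllP.All¬⇒¬Any r₁∉ (subst (_∈ r₂ ∷ rs) (v⇒c (adj-sym z~v) ⟨ trans ⟩ sym (v⇒c (Linked.head lk))) z∈)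

module Homomorphism {m n m′ n′} {S : Subgraph m n} {S′ : Subgraph m′ n′}
  (φ : Vertex m n → Vertex m′ n′) (adj-φ : ∀ {u v} → Adj S u v → Adj S′ (φ u) (φ v)) where

  walk-map : ∀ {u v} → Walk S u v → Walk S′ (φ u) (φ v)
  walk-map []      = []
  walk-map (a ∷ w) = adj-φ a ∷ walk-map w

  connected-map : (∀ v → ∃ λ u → φ u ≡ v) → Connected S → Connected S′
  connected-map φ-surj con u′ v′ with φ-surj u′ | φ-surj v′
  ... | u , refl | v , refl = walk-map (con u v)

  cycle-map : (∀ {u v} → φ u ≡ φ v → u ≡ v) → HasCycle S → HasCycle S′
  cycle-map φ-inj (u , rest , len , uniq , lk) =
    φ u , List.map φ rest ,
    subst (2 ≤_) (sym (ListP.length-map φ rest)) len ,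
    UniqueP.map⁺ φ-inj uniq ,
    subst (Linked (Adj S′)) (cong (φ u ∷_) (ListP.map-++ φ rest (u ∷ []))) (LinkedP.map⁺ (Linked.map adj-φ lk))

  acyclic-pullback : (∀ {u v} → φ u ≡ φ v → u ≡ v) → Acyclic S′ → Acyclic S
  acyclic-pullback φ-inj acyc = acyc ∘ cycle-map φ-inj

cycle-reflect : ∀ {m n m′ n′} {S : Subgraph m n} {S′ : Subgraph m′ n′} (φ : Vertex m n → Vertex m′ n′) →
  (∀ {u v} → Adj S′ (φ u) (φ v) → Adj S u v) →
  ∀ {u rest} → CycleAt S′ (φ u) (List.map φ rest) → CycleAt S u rest
cycle-reflect {S′ = S′} φ adj-φ⁻ {u} {rest} (len , uniq , lk) =
  subst (2 ≤_) (ListP.length-map φ rest) len ,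
  UniqueP.map⁻ uniq ,
  Linked.map adj-φ⁻ 
    (LinkedP.map⁻ (subst (Linked (Adj S′)) (cong (φ u ∷_) (sym (ListP.map-++ φ rest (u ∷ [])))) lk))

transpose-tree : {S : Subgraph m n} → IsSpanningTree S → IsSpanningTree (transpose S)
transpose-tree {S = S} (con , acyc) =
  Homomorphism.connected-map swap adj-transpose (λ v → swap v , swap-involutive v) con ,
  Homomorphism.acyclic-pullback swap adj-transpose⁻ swap-injective acyc

-- Adding and removing a leaf

unitRow : Fin n → Vec Bool n
unitRow j = tabulate (λ j′ → does (j′ ≟ j))

addLeaf : Fin (suc m) → Fin n → Subgraph m n → Subgraph (suc m) n
addLeaf i j T = insertAt T i (unitRow j)

punchInᵛ : Fin (suc m) → Vertex m n → Vertex (suc m) n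
punchInᵛ i (inj₁ a) = inj₁ (punchIn i a)
punchInᵛ i (inj₂ b) = inj₂ b

module _ (i : Fin (suc m)) where

  punchInᵛ-injective : {u v : Vertex m n} → punchInᵛ i u ≡ punchInᵛ i v → u ≡ v
  punchInᵛ-injective {u = inj₁ a} {inj₁ a′} eq = cong inj₁ (FinP.punchIn-injective i a a′ (inj₁-injective eq))
  punchInᵛ-injective {u = inj₂ b} {inj₂ .b} refl = refl

  punchInᵛ≢ : (v : Vertex m n) → punchInᵛ i v ≢ inj₁ i
  punchInᵛ≢ (inj₁ a) eq = FinP.punchInᵢ≢i i a (inj₁-injective eq)

  punchInᵛ-or-≡ : (x : Vertex (suc m) n) → x ≡ inj₁ i ⊎ ∃ λ v → x ≡ punchInᵛ i v
  punchInᵛ-or-≡ (inj₂ b) = inj₂ (inj₂ b , refl)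
  punchInᵛ-or-≡ (inj₁ a) with i ≟ a
  ... | yes refl = inj₁ refl
  ... | no i≢a   = inj₂ (inj₁ (punchOut i≢a) , cong inj₁ (sym (FinP.punchIn-punchOut i≢a)))

  ∉⇒punchInᵛ-image : (xs : List (Vertex (suc m) n)) → inj₁ i ∉ xs →
                     ∃ λ ys → xs ≡ List.map (punchInᵛ i) ys
  ∉⇒punchInᵛ-image []       _   = [] , refl
  ∉⇒punchInᵛ-image (x ∷ xs) i∉ with punchInᵛ-or-≡ x | ∉⇒punchInᵛ-image xs (i∉ ∘ there)
  ... | inj₁ refl       | _           = ⊥-elim (i∉ (here refl))
  ... | inj₂ (v , refl) | vs , refl = v ∷ vs , refl

module AddLeaf (i : Fin (suc m)) (j : Fin n) (T : Subgraph m n) where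

  private
    S = addLeaf i j T
    ι = punchInᵛ {n = n} i
    leaf = inj₁ {B = Fin n} i
    hub = inj₂ {A = Fin (suc m)} j

  edge-leaf : ∀ j′ → edge S i j′ ≡ does (j′ ≟ j)
  edge-leaf j′ rewrite VecP.insertAt-lookup T i (unitRow j) = VecP.lookup∘tabulate (λ j′ → does (j′ ≟ j)) j′

  edge-punchIn : ∀ a b → edge S (punchIn i a) b ≡ edge T a b
  edge-punchIn a b rewrite VecP.insertAt-punchIn T i (unitRow j) a = refl

  adj-punchIn : ∀ {u v} → Adj T u v → Adj S (ι u) (ι v)
  adj-punchIn (lr a b e) = lr (punchIn i a) b (edge-punchIn a b ⟨ trans ⟩ e)
  adj-punchIn (rl a b e) = rl (punchIn i a) b (edge-punchIn a b ⟨ trans ⟩ e)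

  adj-punchIn⁻ : ∀ {u v} → Adj S (ι u) (ι v) → Adj T u v
  adj-punchIn⁻ {inj₁ a} {inj₂ b} (lr _ _ e) = lr a b (sym (edge-punchIn a b) ⟨ trans ⟩ e)
  adj-punchIn⁻ {inj₂ b} {inj₁ a} (rl _ _ e) = rl a b (sym (edge-punchIn a b) ⟨ trans ⟩ e)

  leaf-adj : ∀ {w} → Adj S leaf w → w ≡ hub
  leaf-adj (lr _ j′ e) = cong inj₂ (≟-true⇒≡ (sym (edge-leaf j′) ⟨ trans ⟩ e))

  leaf-edge : Adj S leaf hub
  leaf-edge = lr i j (edge-leaf j ⟨ trans ⟩ dec-true (j ≟ j) refl)

  connected : Connected T → Connected S
  connected con x y = to-hub x ++ʷ from-hub y
    where
    to-hub : ∀ x → Walk S x hub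
    to-hub x with punchInᵛ-or-≡ i x
    ... | inj₁ refl       = leaf-edge ∷ []
    ... | inj₂ (v , refl) = Homomorphism.walk-map ι adj-punchIn (con v (inj₂ j))
    from-hub : ∀ x → Walk S hub x
    from-hub x with punchInᵛ-or-≡ i x
    ... | inj₁ refl       = adj-sym leaf-edge ∷ []
    ... | inj₂ (v , refl) = Homomorphism.walk-map ι adj-punchIn (con (inj₂ j) v)

  acyclic : Acyclic T → Acyclic S
  acyclic acyc (u , rest , cyc) with any? (leaf ≟ᵛ_) (u ∷ rest)
  ... | yes leaf∈ = pendant-not-on-cycle leaf-adj (proj₂ (cycle-through cyc leaf∈))
  ... | no  leaf∉ with u′ ∷ rest′ , refl ← ∉⇒punchInᵛ-image i (u ∷ rest) leaf∉ =
    acyc (u′ , rest′ , cycle-reflect ι adj-punchIn⁻ cyc)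

  tree : IsSpanningTree T → IsSpanningTree S
  tree (con , acyc) = connected con , acyclic acyc

  walk-pullback : ∀ {p q} → Walk S p q → ∀ u v → p ≡ ι u → q ≡ ι v → Walk T u v
  walk-pullback [] u v refl q≡ = subst (Walk T u) (punchInᵛ-injective i q≡) []
  walk-pullback (_∷_ {w = w} a walk) u v refl q≡ with punchInᵛ-or-≡ i w
  ... | inj₂ (w′ , refl) = adj-punchIn⁻ a ∷ walk-pullback walk w′ v refl q≡
  ... | inj₁ refl with walk
  ...   | []         = ⊥-elim (punchInᵛ≢ i v (sym q≡))
  ...   | a′ ∷ walk′ = walk-pullback walk′ u v (leaf-adj a′ ⟨ trans ⟩ sym (leaf-adj (adj-sym a))) q≡

  tree⁻ : IsSpanningTree S → IsSpanningTree T
  tree⁻ (con , acyc) =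
    (λ u v → walk-pullback (con (ι u) (ι v)) u v refl refl) ,
    Homomorphism.acyclic-pullback ι adj-punchIn (punchInᵛ-injective i) acyc

  degree-leaf : degree S leaf ≡ 1
  degree-leaf rewrite VecP.insertAt-lookup T i (unitRow j) =
    sumVec-map boolToℕ (unitRow j) ⟨ trans ⟩
    ℕΣ.sum-cong-≗ (λ x → cong boolToℕ (VecP.lookup∘tabulate (λ j′ → does (j′ ≟ j)) x)) ⟨ trans ⟩
    ∑-δ j

  degree-punchIn : ∀ a → degree S (inj₁ (punchIn i a)) ≡ degree T (inj₁ a)
  degree-punchIn a rewrite VecP.insertAt-punchIn T i (unitRow j) a = refl

  degree-right : ∀ b → degree S (inj₂ b) ≡ δ b j + degree T (inj₂ b)
  degree-right b = begin
    sumVec (Vec.map h S)                          ≡⟨ sumVec-map h S ⟩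
    ℕΣ.sum (h ∘ lookup S)                         ≡⟨ ℕΣ.sum-remove {i = i} (h ∘ lookup S) ⟩
    h (lookup S i) + ℕΣ.sum (h ∘ lookup S ∘ punchIn i)
      ≡⟨ cong₂ _+_ (cong h (VecP.insertAt-lookup T i (unitRow j)))
                   (ℕΣ.sum-cong-≗ (cong h ∘ VecP.insertAt-punchIn T i (unitRow j))) ⟩
    h (unitRow j) + ℕΣ.sum (h ∘ lookup T)
      ≡⟨ cong₂ _+_ (cong boolToℕ (VecP.lookup∘tabulate _ b)) (sym (sumVec-map h T)) ⟩
    δ b j + degree T (inj₂ b)                     ∎
    where
    open ≡-Reasoning
    h : Vec Bool n → ℕ
    h row = boolToℕ (lookup row b)

unitRow-injective : {j j′ : Fin n} → unitRow j ≡ unitRow j′ → j ≡ j′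
unitRow-injective {j = j} {j′} eq = ≟-true⇒≡ (begin
  does (j ≟ j′)          ≡⟨ VecP.lookup∘tabulate _ j ⟨
  lookup (unitRow j′) j  ≡⟨ cong (λ r → lookup r j) eq ⟨
  lookup (unitRow j) j   ≡⟨ VecP.lookup∘tabulate _ j ⟩
  does (j ≟ j)           ≡⟨ dec-true (j ≟ j) refl ⟩
  true                   ∎)
  where open ≡-Reasoning

addLeaf-injective : (i : Fin (suc m)) {j j′ : Fin n} {X X′ : Subgraph m n} →
                    addLeaf i j X ≡ addLeaf i j′ X′ → j ≡ j′ × X ≡ X′
addLeaf-injective i {j} {j′} {X} {X′} eq =
  unitRow-injective
    (sym (VecP.insertAt-lookup X i _) ⟨ trans ⟩ cong (λ S → lookup S i) eq ⟨ trans ⟩ VecP.insertAt-lookup X′ i _) ,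
  (sym (VecP.removeAt-insertAt X i _) ⟨ trans ⟩ cong (λ S → removeAt S i) eq ⟨ trans ⟩
   VecP.removeAt-insertAt X′ i _)

addLeafʳ : Fin (suc n) → Fin m → Subgraph m n → Subgraph m (suc n)
addLeafʳ j i T = transpose (addLeaf j i (transpose T))

addLeafʳ-tree : (j : Fin (suc n)) (i : Fin m) {T : Subgraph m n} → IsSpanningTree T → IsSpanningTree (addLeafʳ j i T)
addLeafʳ-tree j i t = transpose-tree (AddLeaf.tree j i _ (transpose-tree t))

rowSum : Vec Bool n → ℕ
rowSum r = sumVec (Vec.map boolToℕ r)

rowSum≡1⇒unitRow : (r : Vec Bool n) → rowSum r ≡ 1 → ∃ λ j → r ≡ unitRow j
rowSum≡1⇒unitRow (true  ∷ r) eq = zero , cong (true ∷_) (rowSum≡0⇒false r (ℕP.suc-injective eq))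
  where
  rowSum≡0⇒false : (r : Vec Bool n) → rowSum r ≡ 0 → r ≡ tabulate (λ _ → false)
  rowSum≡0⇒false []          _  = refl
  rowSum≡0⇒false (false ∷ r) eq = cong (false ∷_) (rowSum≡0⇒false r eq)
rowSum≡1⇒unitRow (false ∷ r) eq with j , refl ← rowSum≡1⇒unitRow r eq = suc j , refl

rowSum≢0⇒true : (r : Vec Bool n) → rowSum r ≢ 0 → ∃ λ j → lookup r j ≡ true
rowSum≢0⇒true []          ≢0 = ⊥-elim (≢0 refl)
rowSum≢0⇒true (true  ∷ r) ≢0 = zero , refl
rowSum≢0⇒true (false ∷ r) ≢0 with j , e ← rowSum≢0⇒true r ≢0 = suc j , e

rowSum≢1⇒another-true : (r : Vec Bool n) {j : Fin n} → lookup r j ≡ true → rowSum r ≢ 1 →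
                         ∃ λ j′ → j′ ≢ j × lookup r j′ ≡ true
rowSum≢1⇒another-true (true ∷ r) {zero} _ ≢1 with j′ , e ← rowSum≢0⇒true r (≢1 ∘ cong suc) =
  suc j′ , (λ ()) , e
rowSum≢1⇒another-true (true  ∷ r) {suc j} _ _  = zero , (λ ()) , refl
rowSum≢1⇒another-true (false ∷ r) {suc j} e ≢1 with j′ , j′≢j , e′ ← rowSum≢1⇒another-true r e ≢1 =
  suc j′ , j′≢j ∘ FinP.suc-injective , e′

leaf-decomposition : (T : Subgraph (suc m) n) (i : Fin (suc m)) → IsSpanningTree T → degree T (inj₁ i) ≡ 1 →
                     ∃ λ j → ∃ λ T′ → T ≡ addLeaf i j T′ × IsSpanningTree T′
leaf-decomposition T i t deg with j , row≡ ← rowSum≡1⇒unitRow (lookup T i) deg =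
  j , removeAt T i , T≡ , AddLeaf.tree⁻ i j (removeAt T i) (subst IsSpanningTree T≡ t)
  where
  T≡ : T ≡ addLeaf i j (removeAt T i)
  T≡ = sym (VecP.insertAt-removeAt T i) ⟨ trans ⟩ cong (insertAt (removeAt T i) i) row≡

leaf-decompositionʳ : (T : Subgraph m (suc n)) (j : Fin (suc n)) → IsSpanningTree T → degree T (inj₂ j) ≡ 1 →
                      ∃ λ i → ∃ λ T′ → T ≡ addLeafʳ j i T′ × IsSpanningTree T′
leaf-decompositionʳ T j t deg
  with i , X , T≡ , tX ← leaf-decomposition (transpose T) j (transpose-tree t)
                                             (degree-transpose T (inj₁ j) ⟨ trans ⟩ deg) =
  i , transpose X , T≡′ , transpose-tree tX
  where
  T≡′ : T ≡ addLeafʳ j i (transpose X)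
  T≡′ = begin
    T                                          ≡⟨ transpose-involutive T ⟨
    transpose (transpose T)                    ≡⟨ cong transpose T≡ ⟩
    transpose (addLeaf j i X)                  ≡⟨ cong (transpose ∘ addLeaf j i) (transpose-involutive X) ⟨
    transpose (addLeaf j i (transpose (transpose X))) ∎
    where open ≡-Reasoning

other-neighbour : (T : Subgraph m n) {v p : Vertex m n} → Adj T v p → degree T v ≢ 1 →
                  ∃ λ w → Adj T v w × w ≢ p
other-neighbour T (lr i j e) ≢1 with j′ , j′≢j , e′ ← rowSum≢1⇒another-true (lookup T i) e ≢1 =
  inj₂ j′ , lr i j′ e′ , j′≢j ∘ inj₂-injective
other-neighbour T a@(rl i j e) ≢1
  with w , a′ , w≢ ← other-neighbour (transpose T) (adj-transpose a)
                                      (≢1 ∘ trans (sym (degree-transpose T (inj₁ j)))) =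
  swap w , adj-transpose⁻ a′ , w≢ ∘ λ eq → sym (swap-involutive w) ⟨ trans ⟩ cong swap eq

unique⇒length≤ : {xs : List (Vertex m n)} → Unique xs → length xs ≤ m + n
unique⇒length≤ {m} {n} {xs} uniq = FinP.injective⇒≤ {f = Fin.join m n ∘ List.lookup xs} λ {p} {q} eq →
  lookup-injective uniq p q
    (sym (FinP.splitAt-join m n _) ⟨ trans ⟩ cong (Fin.splitAt m) eq ⟨ trans ⟩ FinP.splitAt-join m n _)

module _ {T : Subgraph m n} (acyc : Acyclic T) where

  no-chord : ∀ v q ys w zs → Unique (v ∷ q ∷ ys ++ w ∷ zs) → Linked (Adj T) (v ∷ q ∷ ys ++ w ∷ zs) →
             ¬ Adj T v w
  no-chord v q ys w zs uniq lk v~w = acyc (v , q ∷ ys ++ w ∷ [] , len , uniq′ , lk′)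
    where
    split : v ∷ q ∷ ys ++ w ∷ zs ≡ (v ∷ q ∷ ys ++ w ∷ []) ++ zs
    split = cong (λ xs → v ∷ q ∷ xs) (sym (ListP.++-assoc ys (w ∷ []) zs))
    len : 2 ≤ length (q ∷ ys ++ w ∷ [])
    len = subst (λ l → 2 ≤ suc l) (sym (length-∷ʳ ys w)) (s≤s (s≤s z≤n))
    uniq′ : Unique (v ∷ q ∷ ys ++ w ∷ [])
    uniq′ = unique-++⁻ˡ (v ∷ q ∷ ys ++ w ∷ []) (subst Unique split uniq)
    lk′ : Linked (Adj T) (v ∷ (q ∷ ys ++ w ∷ []) ++ v ∷ [])
    lk′ = subst (λ xs → Linked (Adj T) (v ∷ q ∷ xs)) (sym (ListP.++-assoc ys (w ∷ []) (v ∷ [])))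
            (linked-∷ʳ (v ∷ q ∷ ys) (linked-++⁻ˡ (v ∷ q ∷ ys ++ w ∷ []) (subst (Linked (Adj T)) split lk))
                       (adj-sym v~w))

  -- The path v ∷ q ∷ rest grows at v; having no repeated vertex it has at most m + n of them,
  -- so the fuel is never exhausted.
  path-ends-in-leaf : ∀ fuel v q rest → m + n < length (v ∷ q ∷ rest) + fuel →
                      Unique (v ∷ q ∷ rest) → Linked (Adj T) (v ∷ q ∷ rest) → ∃ λ x → degree T x ≡ 1
  path-ends-in-leaf zero v q rest lt uniq lk =
    ⊥-elim (ℕP.<⇒≱ lt (subst (_≤ m + n) (sym (ℕP.+-identityʳ _)) (unique⇒length≤ uniq)))
  path-ends-in-leaf (suc fuel) v q rest lt uniq lk with degree T v ℕ.≟ 1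
  ... | yes deg≡1 = v , deg≡1
  ... | no  deg≢1 with w , v~w , w≢q ← other-neighbour T (Linked.head lk) deg≢1 with any? (w ≟ᵛ_) (v ∷ q ∷ rest)
  ...   | yes (here w≡v)         = ⊥-elim (adj⇒≢ v~w (sym w≡v))
  ...   | yes (there (here w≡q)) = ⊥-elim (w≢q w≡q)
  ...   | yes (there (there w∈)) with ys , zs , refl ← ∈-∃++ w∈ = ⊥-elim (no-chord v q ys w zs uniq lk v~w)
  ...   | no w∉ = path-ends-in-leaf fuel w v (q ∷ rest) (subst (m + n <_) (ℕP.+-suc _ fuel) lt)
                    (AllP.¬Any⇒All¬ _ w∉ ∷ uniq) (adj-sym v~w ∷ lk)

tree-has-leaf : (T : Subgraph (suc m) (suc n)) → IsSpanningTree T → ∃ λ x → degree T x ≡ 1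
tree-has-leaf {m} {n} T (con , acyc) with con (inj₁ zero) (inj₂ zero)
... | _∷_ {w = w} a _ =
  path-ends-in-leaf acyc N w (inj₁ zero) [] (ℕP.m<n+m N {2} (s≤s z≤n))
    ((adj⇒≢ a ∘ sym ∷ []) ∷ [] ∷ []) (adj-sym a ∷ [-])
  where N = suc m + suc n

-- The Prüfer-type code

star : Subgraph 1 n
star = Vec.replicate _ true ∷ []

edge-star : (j : Fin n) → edge star zero j ≡ true
edge-star j = VecP.lookup-replicate j true

adj-from-right₁ : {S : Subgraph 1 n} {j : Fin n} {w : Vertex 1 n} → Adj S (inj₂ j) w → w ≡ inj₁ zero
adj-from-right₁ (rl zero _ _) = refl

star-acyclic : (S : Subgraph 1 n) → Acyclic S
star-acyclic S (inj₂ j , rest , cyc) = pendant-not-on-cycle adj-from-right₁ cyc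
star-acyclic S (inj₁ zero , inj₂ j ∷ rest , cyc) =
  pendant-not-on-cycle adj-from-right₁ (proj₂ (cycle-through cyc (there (here refl))))
star-acyclic S (inj₁ zero , inj₁ _ ∷ _ , _ , _ , () ∷ _)

star-tree : IsSpanningTree (star {n})
star-tree = connected , star-acyclic star
  where
  connected : Connected star
  connected (inj₁ zero) (inj₁ zero) = []
  connected (inj₁ zero) (inj₂ j)    = lr zero j (edge-star j) ∷ []
  connected (inj₂ j)    (inj₁ zero) = rl zero j (edge-star j) ∷ []
  connected (inj₂ j)    (inj₂ j′)   = rl zero j (edge-star j) ∷ lr zero j′ (edge-star j′) ∷ []

star-unique : (T : Subgraph 1 n) → IsSpanningTree T → T ≡ star
star-unique T (con , _) = subgraph-ext λ { zero j → edge-left j ⟨ trans ⟩ sym (edge-star j) }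
  where
  edge-left : ∀ j → edge T zero j ≡ true
  edge-left j with rl zero .j e ∷ _ ← con (inj₂ j) (inj₁ zero) = e

record DegreeCode (f : Vec (Fin m) k) (g : Vec (Fin n) l) (T : Subgraph m n) : Set where
  constructor degrees
  field
    degreeˡ : ∀ x → degree T (inj₁ x) ≡ suc (occ x f)
    degreeʳ : ∀ y → degree T (inj₂ y) ≡ suc (occ y g)

open DegreeCode

DegreeCode-transpose : {f : Vec (Fin m) k} {g : Vec (Fin n) l} {T : Subgraph m n} →
                       DegreeCode f g T → DegreeCode g f (transpose T)
DegreeCode-transpose {T = T} (degrees left right) = degrees
  (λ y → degree-transpose T (inj₁ y) ⟨ trans ⟩ right y)
  (λ x → degree-transpose T (inj₂ x) ⟨ trans ⟩ left x)

star-degrees : (f : Vec (Fin 1) k) → DegreeCode f [] (star {suc k})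
star-degrees {k} f = degrees (λ { zero → rowSum-replicate (suc k) ⟨ trans ⟩ cong suc (sym (occ-1 f)) })
                             (λ y → cong (λ b → boolToℕ b + 0) (edge-star y))
  where
  rowSum-replicate : ∀ n → rowSum (Vec.replicate n true) ≡ n
  rowSum-replicate zero    = refl
  rowSum-replicate (suc n) = cong suc (rowSum-replicate n)
  occ-1 : ∀ {k} (f : Vec (Fin 1) k) → occ zero f ≡ k
  occ-1 []         = refl
  occ-1 (zero ∷ f) = cong suc (occ-1 f)

-- A left inverse of punchIn i; its value at i itself is junk.
punchIn⁻¹ : Fin (suc (suc k)) → Fin (suc (suc k)) → Fin (suc k)
punchIn⁻¹ i x with i ≟ x
... | yes _   = zero
... | no  i≢x = punchOut i≢x

module _ (i : Fin (suc (suc k))) where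

  punchIn-punchIn⁻¹ : ∀ {x} → i ≢ x → punchIn i (punchIn⁻¹ i x) ≡ x
  punchIn-punchIn⁻¹ {x} i≢x with i ≟ x
  ... | yes i≡x = ⊥-elim (i≢x i≡x)
  ... | no  i≢x = FinP.punchIn-punchOut i≢x

  punchIn⁻¹-punchIn : ∀ a → punchIn⁻¹ i (punchIn i a) ≡ a
  punchIn⁻¹-punchIn a = FinP.punchIn-injective i _ _ (punchIn-punchIn⁻¹ (FinP.punchInᵢ≢i i a ∘ sym))

  δ-punchIn⁻¹ : ∀ a {y} → i ≢ y → δ a (punchIn⁻¹ i y) ≡ δ (punchIn i a) y
  δ-punchIn⁻¹ a {y} i≢y = cong boolToℕ (does-≡ (map′ to from (a ≟ punchIn⁻¹ i y)) (punchIn i a ≟ y))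
    where
    to : a ≡ punchIn⁻¹ i y → punchIn i a ≡ y
    to refl = punchIn-punchIn⁻¹ i≢y
    from : punchIn i a ≡ y → a ≡ punchIn⁻¹ i y
    from refl = sym (punchIn⁻¹-punchIn a)

  occ-map-punchIn⁻¹ : (v : Vec (Fin (suc (suc k))) l) → occ i v ≡ 0 →
                      ∀ a → occ a (Vec.map (punchIn⁻¹ i) v) ≡ occ (punchIn i a) v
  occ-map-punchIn⁻¹ []      _  a = refl
  occ-map-punchIn⁻¹ (y ∷ v) eq a with i≢y , eq′ ← occ-∷≡0 v eq =
    cong₂ _+_ (δ-punchIn⁻¹ a i≢y) (occ-map-punchIn⁻¹ v eq′ a)

  map-punchIn⁻¹-punchIn : (v : Vec (Fin (suc k)) l) → Vec.map (punchIn⁻¹ i) (Vec.map (punchIn i) v) ≡ v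
  map-punchIn⁻¹-punchIn []      = refl
  map-punchIn⁻¹-punchIn (a ∷ v) = cong₂ _∷_ (punchIn⁻¹-punchIn a) (map-punchIn⁻¹-punchIn v)

  map-punchIn⁻¹-injective : {v v′ : Vec (Fin (suc (suc k))) l} → occ i v ≡ 0 → occ i v′ ≡ 0 →
                            Vec.map (punchIn⁻¹ i) v ≡ Vec.map (punchIn⁻¹ i) v′ → v ≡ v′
  map-punchIn⁻¹-injective {v = []}    {[]}      _  _   _  = refl
  map-punchIn⁻¹-injective {v = y ∷ v} {y′ ∷ v′} eq eq′ e
    with i≢y , eq₁ ← occ-∷≡0 v eq | i≢y′ , eq₁′ ← occ-∷≡0 v′ eq′ | e₀ , e₁ ← VecP.∷-injective e =
    cong₂ _∷_ (sym (punchIn-punchIn⁻¹ i≢y) ⟨ trans ⟩ cong (punchIn i) e₀ ⟨ trans ⟩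
               punchIn-punchIn⁻¹ i≢y′)
              (map-punchIn⁻¹-injective eq₁ eq₁′ e₁)

occ-map-punchIn : (i : Fin (suc k)) (v : Vec (Fin k) l) → occ i (Vec.map (punchIn i) v) ≡ 0
occ-map-punchIn i []      = refl
occ-map-punchIn i (a ∷ v) rewrite dec-false (i ≟ punchIn i a) (FinP.punchInᵢ≢i i a ∘ sym) = occ-map-punchIn i v

addLeaf-degrees : (i : Fin (suc (suc k))) (j : Fin n) {f : Vec (Fin (suc (suc k))) l} {g : Vec (Fin n) l′}
                  {X : Subgraph (suc k) n} → occ i f ≡ 0 →
                  DegreeCode (Vec.map (punchIn⁻¹ i) f) g X → DegreeCode f (j ∷ g) (addLeaf i j X)
addLeaf-degrees i j {f} {g} {X} occ≡0 (degrees left right) = degrees left′ right′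
  where
  open AddLeaf i j X
  left′ : ∀ x → degree (addLeaf i j X) (inj₁ x) ≡ suc (occ x f)
  left′ x with i ≟ x
  ... | yes refl = degree-leaf ⟨ trans ⟩ cong suc (sym occ≡0)
  ... | no  i≢x  = subst (λ x → degree (addLeaf i j X) (inj₁ x) ≡ suc (occ x f)) (FinP.punchIn-punchOut i≢x)
    (degree-punchIn _ ⟨ trans ⟩ left _ ⟨ trans ⟩ cong suc (occ-map-punchIn⁻¹ i f occ≡0 _))
  right′ : ∀ y → degree (addLeaf i j X) (inj₂ y) ≡ suc (occ y (j ∷ g))
  right′ y = degree-right y ⟨ trans ⟩ cong (λ d → δ y j + d) (right y) ⟨ trans ⟩ ℕP.+-suc (δ y j) _

addLeafʳ-degrees : (j : Fin (suc (suc k))) (x : Fin m) {f : Vec (Fin m) l} {g : Vec (Fin (suc (suc k))) l′}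
                   {X : Subgraph m (suc k)} → occ j g ≡ 0 →
                   DegreeCode f (Vec.map (punchIn⁻¹ j) g) X → DegreeCode (x ∷ f) g (addLeafʳ j x X)
addLeafʳ-degrees j x occ≡0 code = DegreeCode-transpose (addLeaf-degrees j x occ≡0 (DegreeCode-transpose code))

findᵇ : (Fin n → Bool) → Maybe (Fin n)
findᵇ {zero}  p = nothing
findᵇ {suc n} p = if p zero then just zero else Maybe.map suc (findᵇ (p ∘ suc))

findᵇ-cong : {p q : Fin n → Bool} → (∀ x → p x ≡ q x) → findᵇ p ≡ findᵇ q
findᵇ-cong {zero}  p≗q = refl
findᵇ-cong {suc n} p≗q =
  cong₂ (λ b r → if b then just zero else Maybe.map suc r) (p≗q zero) (findᵇ-cong (p≗q ∘ suc))

findᵇ-just : (p : Fin n → Bool) {i : Fin n} → findᵇ p ≡ just i → T (p i)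
findᵇ-just {suc n} p eq with p zero in p₀ | findᵇ (p ∘ suc) in e
findᵇ-just {suc n} p {zero}  refl | true  | _      = subst T (sym p₀) _
findᵇ-just {suc n} p {suc i} refl | false | just _ = findᵇ-just (p ∘ suc) e

findᵇ-nothing : (p : Fin n → Bool) → findᵇ p ≡ nothing → ∀ x → ¬ T (p x)
findᵇ-nothing {suc n} p eq x with p zero in p₀ | findᵇ (p ∘ suc) in e
findᵇ-nothing {suc n} p refl zero    | false | nothing = subst (¬_ ∘ T) (sym p₀) id
findᵇ-nothing {suc n} p refl (suc x) | false | nothing = findᵇ-nothing (p ∘ suc) e x

firstMissing : Vec (Fin m) k → Maybe (Fin m)
firstMissing v = findᵇ (λ x → occ x v ≡ᵇ 0)

firstMissing-just : (v : Vec (Fin m) k) {i : Fin m} → firstMissing v ≡ just i → occ i v ≡ 0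
firstMissing-just v eq = ℕP.≡ᵇ⇒≡ _ 0 (findᵇ-just _ eq)

firstMissing-nothing : (v : Vec (Fin m) k) → firstMissing v ≡ nothing → ∀ x → occ x v ≢ 0
firstMissing-nothing v eq x occ≡0 = findᵇ-nothing _ eq x (ℕP.≡⇒≡ᵇ _ 0 occ≡0)

Code : ℕ → ℕ → Set
Code a b = Vec (Fin (suc a)) b × Vec (Fin (suc b)) a

some-letter-missing : ∀ {a b} ((f , g) : Code a b) → firstMissing f ≡ nothing → firstMissing g ≡ nothing → ⊥
some-letter-missing {a} {b} (f , g) ef eg = ℕP.<-irrefl refl
  (ℕP.≤-trans (all-occur⇒≤ f (firstMissing-nothing f ef))
              (ℕP.≤-trans (ℕP.n≤1+n b) (all-occur⇒≤ g (firstMissing-nothing g eg))))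

-- The last clause of decodeStep is unreachable by some-letter-missing.
decode : ∀ a b → Code a b → Subgraph (suc a) (suc b)
decodeStep : ∀ a b → Maybe (Fin (suc (suc a))) → Maybe (Fin (suc (suc b))) →
             Code (suc a) (suc b) → Subgraph (suc (suc a)) (suc (suc b))

decode zero    b       _       = star
decode (suc a) zero    _       = transpose star
decode (suc a) (suc b) (f , g) = decodeStep a b (firstMissing f) (firstMissing g) (f , g)

decodeStep a b (just i) _        (f , j ∷ g) = addLeaf i j (decode a (suc b) (Vec.map (punchIn⁻¹ i) f , g))
decodeStep a b nothing  (just j) (i ∷ f , g) = addLeafʳ j i (decode (suc a) b (f , Vec.map (punchIn⁻¹ j) g))
decodeStep a b nothing  nothing  _           = Vec.replicate _ (Vec.replicate _ false)

decode-sound : ∀ a b ((f , g) : Code a b) → IsSpanningTree (decode a b (f , g)) × DegreeCode f g (decode a b (f , g))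
decodeStep-sound : ∀ a b {mi mj} ((f , g) : Code (suc a) (suc b)) → firstMissing f ≡ mi → firstMissing g ≡ mj →
                   IsSpanningTree (decodeStep a b mi mj (f , g)) × DegreeCode f g (decodeStep a b mi mj (f , g))

decode-sound zero    b       (f , [])  = star-tree , star-degrees f
decode-sound (suc a) zero    ([] , g)  = transpose-tree star-tree , DegreeCode-transpose (star-degrees g)
decode-sound (suc a) (suc b) c         = decodeStep-sound a b c refl refl

decodeStep-sound a b {just i} (f , j ∷ g) ef _
  with t , code ← decode-sound a (suc b) (Vec.map (punchIn⁻¹ i) f , g) =
  AddLeaf.tree i j _ t , addLeaf-degrees i j (firstMissing-just f ef) code
decodeStep-sound a b {nothing} {just j} (i ∷ f , g) _ eg
  with t , code ← decode-sound (suc a) b (f , Vec.map (punchIn⁻¹ j) g) =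
  addLeafʳ-tree j i t , addLeafʳ-degrees j i (firstMissing-just g eg) code
decodeStep-sound a b {nothing} {nothing} c ef eg = ⊥-elim (some-letter-missing c ef eg)

Fin1-words-equal : (v v′ : Vec (Fin 1) k) → v ≡ v′
Fin1-words-equal []       []         = refl
Fin1-words-equal (zero ∷ v) (zero ∷ v′) = cong (zero ∷_) (Fin1-words-equal v v′)

firstLeafˡ : Subgraph m n → Maybe (Fin m)
firstLeafˡ T = findᵇ (λ x → degree T (inj₁ x) ≡ᵇ 1)

firstLeafʳ : Subgraph m n → Maybe (Fin n)
firstLeafʳ T = findᵇ (λ y → degree T (inj₂ y) ≡ᵇ 1)

module _ (T : Subgraph m n) where

  firstLeafˡ-just : ∀ {i} → firstLeafˡ T ≡ just i → degree T (inj₁ i) ≡ 1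
  firstLeafˡ-just eq = ℕP.≡ᵇ⇒≡ _ 1 (findᵇ-just (λ x → degree T (inj₁ x) ≡ᵇ 1) eq)

  firstLeafʳ-just : ∀ {j} → firstLeafʳ T ≡ just j → degree T (inj₂ j) ≡ 1
  firstLeafʳ-just eq = ℕP.≡ᵇ⇒≡ _ 1 (findᵇ-just (λ y → degree T (inj₂ y) ≡ᵇ 1) eq)

  firstLeafˡ-nothing : firstLeafˡ T ≡ nothing → ∀ x → degree T (inj₁ x) ≢ 1
  firstLeafˡ-nothing eq x = findᵇ-nothing (λ x → degree T (inj₁ x) ≡ᵇ 1) eq x ∘ ℕP.≡⇒≡ᵇ _ 1

  firstLeafʳ-nothing : firstLeafʳ T ≡ nothing → ∀ y → degree T (inj₂ y) ≢ 1
  firstLeafʳ-nothing eq y = findᵇ-nothing (λ y → degree T (inj₂ y) ≡ᵇ 1) eq y ∘ ℕP.≡⇒≡ᵇ _ 1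

module _ {f : Vec (Fin m) k} {g : Vec (Fin n) l} {T : Subgraph m n} (code : DegreeCode f g T) where

  firstMissing-firstLeafˡ : firstMissing f ≡ firstLeafˡ T
  firstMissing-firstLeafˡ = findᵇ-cong (λ x → cong (_≡ᵇ 1) (sym (degreeˡ code x)))

  firstMissing-firstLeafʳ : firstMissing g ≡ firstLeafʳ T
  firstMissing-firstLeafʳ = findᵇ-cong (λ y → cong (_≡ᵇ 1) (sym (degreeʳ code y)))

decode-injective : ∀ a b (c c′ : Code a b) → decode a b c ≡ decode a b c′ → c ≡ c′
decodeStep-injective : ∀ a b {mi mj} ((f , g) (f′ , g′) : Code (suc a) (suc b)) →
  firstMissing f ≡ mi → firstMissing f′ ≡ mi → firstMissing g ≡ mj → firstMissing g′ ≡ mj →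
  decodeStep a b mi mj (f , g) ≡ decodeStep a b mi mj (f′ , g′) → (f , g) ≡ (f′ , g′)

decode-injective zero    b       (f , []) (f′ , []) _ = cong (_, []) (Fin1-words-equal f f′)
decode-injective (suc a) zero    ([] , g) ([] , g′) _ = cong ([] ,_) (Fin1-words-equal g g′)
decode-injective (suc a) (suc b) c@(f , g) c′@(f′ , g′) eq =
  decodeStep-injective a b c c′ refl ef refl eg (eq ⟨ trans ⟩ cong₂ (λ mi mj → decodeStep a b mi mj c′) ef eg)
  where
  code  = proj₂ (decode-sound (suc a) (suc b) c)
  code′ = proj₂ (decode-sound (suc a) (suc b) c′)
  ef : firstMissing f′ ≡ firstMissing f
  ef = firstMissing-firstLeafˡ code′ ⟨ trans ⟩ cong firstLeafˡ (sym eq) ⟨ trans ⟩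
       sym (firstMissing-firstLeafˡ code)
  eg : firstMissing g′ ≡ firstMissing g
  eg = firstMissing-firstLeafʳ code′ ⟨ trans ⟩ cong firstLeafʳ (sym eq) ⟨ trans ⟩
       sym (firstMissing-firstLeafʳ code)

decodeStep-injective a b {just i} (f , j ∷ g) (f′ , j′ ∷ g′) ef ef′ _ _ eq
  with j≡j′ , rest≡ ← addLeaf-injective i eq
  with code≡ ← decode-injective a (suc b) _ _ rest≡ =
  cong₂ _,_ (map-punchIn⁻¹-injective i (firstMissing-just f ef) (firstMissing-just f′ ef′) (,-injectiveˡ code≡))
            (cong₂ _∷_ j≡j′ (,-injectiveʳ code≡))
decodeStep-injective a b {nothing} {just j} (i ∷ f , g) (i′ ∷ f′ , g′) _ _ eg eg′ eq
  with i≡i′ , rest≡ ← addLeaf-injective j (transpose-injective eq)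
  with code≡ ← decode-injective (suc a) b _ _ (transpose-injective rest≡) =
  cong₂ _,_ (cong₂ _∷_ i≡i′ (,-injectiveˡ code≡))
            (map-punchIn⁻¹-injective j (firstMissing-just g eg) (firstMissing-just g′ eg′) (,-injectiveʳ code≡))
decodeStep-injective a b {nothing} {nothing} c _ ef _ eg _ _ = ⊥-elim (some-letter-missing c ef eg)

decode-addLeaf : ∀ a b {i j} ((f , g) : Code a (suc b)) →
                 firstLeafˡ (addLeaf i j (decode a (suc b) (f , g))) ≡ just i →
                 decode (suc a) (suc b) (Vec.map (punchIn i) f , j ∷ g) ≡ addLeaf i j (decode a (suc b) (f , g))
decode-addLeaf a b {i} {j} (f , g) leaf≡i = begin
  decodeStep a b (firstMissing F) (firstMissing (j ∷ g)) (F , j ∷ g)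
    ≡⟨ cong (λ mi → decodeStep a b mi (firstMissing (j ∷ g)) (F , j ∷ g))
            (firstMissing-firstLeafˡ code ⟨ trans ⟩ leaf≡i) ⟩
  addLeaf i j (decode a (suc b) (Vec.map (punchIn⁻¹ i) F , g))
    ≡⟨ cong (λ f → addLeaf i j (decode a (suc b) (f , g))) (map-punchIn⁻¹-punchIn i f) ⟩
  addLeaf i j (decode a (suc b) (f , g)) ∎
  where
  open ≡-Reasoning
  F = Vec.map (punchIn i) f
  code : DegreeCode F (j ∷ g) (addLeaf i j (decode a (suc b) (f , g)))
  code = addLeaf-degrees i j (occ-map-punchIn i f)
           (subst (λ f′ → DegreeCode f′ g (decode a (suc b) (f , g))) (sym (map-punchIn⁻¹-punchIn i f))
                  (proj₂ (decode-sound a (suc b) (f , g))))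

decode-addLeafʳ : ∀ a b {i j} ((f , g) : Code (suc a) b) →
                  firstLeafˡ (addLeafʳ j i (decode (suc a) b (f , g))) ≡ nothing →
                  firstLeafʳ (addLeafʳ j i (decode (suc a) b (f , g))) ≡ just j →
                  decode (suc a) (suc b) (i ∷ f , Vec.map (punchIn j) g) ≡ addLeafʳ j i (decode (suc a) b (f , g))
decode-addLeafʳ a b {i} {j} (f , g) no-leafˡ leaf≡j = begin
  decodeStep a b (firstMissing (i ∷ f)) (firstMissing G) (i ∷ f , G)
    ≡⟨ cong₂ (λ mi mj → decodeStep a b mi mj (i ∷ f , G))
             (firstMissing-firstLeafˡ code ⟨ trans ⟩ no-leafˡ) (firstMissing-firstLeafʳ code ⟨ trans ⟩ leaf≡j) ⟩
  addLeafʳ j i (decode (suc a) b (f , Vec.map (punchIn⁻¹ j) G))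
    ≡⟨ cong (λ g → addLeafʳ j i (decode (suc a) b (f , g))) (map-punchIn⁻¹-punchIn j g) ⟩
  addLeafʳ j i (decode (suc a) b (f , g)) ∎
  where
  open ≡-Reasoning
  G = Vec.map (punchIn j) g
  code : DegreeCode (i ∷ f) G (addLeafʳ j i (decode (suc a) b (f , g)))
  code = addLeafʳ-degrees j i (occ-map-punchIn j g)
           (subst (λ g′ → DegreeCode f g′ (decode (suc a) b (f , g))) (sym (map-punchIn⁻¹-punchIn j g))
                  (proj₂ (decode-sound (suc a) b (f , g))))

decode-surjective : ∀ a b (T : Subgraph (suc a) (suc b)) → IsSpanningTree T → ∃ λ c → decode a b c ≡ T
decode-surjective zero    b    T t = (Vec.replicate _ zero , []) , sym (star-unique T t)
decode-surjective (suc a) zero T t =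
  ([] , Vec.replicate _ zero) ,
  (cong transpose (sym (star-unique (transpose T) (transpose-tree t))) ⟨ trans ⟩ transpose-involutive T)
decode-surjective (suc a) (suc b) T t with firstLeafˡ T in leafˡ
... | just i
  with j , T′ , refl , t′ ← leaf-decomposition T i t (firstLeafˡ-just T leafˡ)
  with (f , g) , refl ← decode-surjective a (suc b) T′ t′ =
  (Vec.map (punchIn i) f , j ∷ g) , decode-addLeaf a b {i} {j} (f , g) leafˡ
... | nothing with tree-has-leaf T t
...   | inj₁ x , deg = ⊥-elim (firstLeafˡ-nothing T leafˡ x deg)
...   | inj₂ y , deg with firstLeafʳ T in leafʳ
...     | nothing = ⊥-elim (firstLeafʳ-nothing T leafʳ y deg)
...     | just j
  with i , T′ , refl , t′ ← leaf-decompositionʳ T j t (firstLeafʳ-just T leafʳ)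
  with (f , g) , refl ← decode-surjective (suc a) b T′ t′ =
  (i ∷ f , Vec.map (punchIn j) g) , decode-addLeafʳ a b {i} (f , g) leafˡ leafʳ

-- Words with prescribed parities of letter multiplicities

words : ∀ m k → List (Vec (Fin m) k)
words m zero    = [] ∷ []
words m (suc k) = List.cartesianProductWith _∷_ (List.allFin m) (words m k)

∈-words : (v : Vec (Fin m) k) → v ∈ words m k
∈-words []      = here refl
∈-words (x ∷ v) = ∈-cartesianProductWith⁺ _∷_ (∈-allFin x) (∈-words v)

words-unique : ∀ m k → Unique (words m k)
words-unique m zero    = [] ∷ []
words-unique m (suc k) = UniqueP.cartesianProductWith⁺ _∷_ VecP.∷-injective (UniqueP.allFin⁺ m) (words-unique m k)

module _ {A B : Set} {P : A → Set} (P? : Decidable P) where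

  length-filter-map : (f : B → A) (xs : List B) → length (filter P? (List.map f xs)) ≡ length (filter (P? ∘ f) xs)
  length-filter-map f []       = refl
  length-filter-map f (x ∷ xs) with does (P? (f x))
  ... | true  = cong suc (length-filter-map f xs)
  ... | false = length-filter-map f xs

  length-filter-cartesianProductWith : {C : Set} (g : C → B → A) (h : Fin n → C) (ys : List B) →
    length (filter P? (List.cartesianProductWith g (List.tabulate h) ys)) ≡
    ℕΣ.sum (λ x → length (filter (P? ∘ g (h x)) ys))
  length-filter-cartesianProductWith {zero}  g h ys = refl
  length-filter-cartesianProductWith {suc n} g h ys =
    cong length (ListP.filter-++ P? (List.map (g (h zero)) ys) _) ⟨ trans ⟩
    ListP.length-++ (filter P? (List.map (g (h zero)) ys)) ⟨ trans ⟩
    cong₂ _+_ (length-filter-map (g (h zero)) ys) (length-filter-cartesianProductWith g (h ∘ suc) ys)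

oddᵇ : ℕ → Bool
oddᵇ zero    = false
oddᵇ (suc n) = not (oddᵇ n)

%2≡oddᵇ : ∀ n → n % 2 ≡ boolToℕ (oddᵇ n)
%2≡oddᵇ zero          = refl
%2≡oddᵇ (suc zero)    = refl
%2≡oddᵇ (suc (suc n)) = begin
  (2 + n) % 2              ≡⟨ cong (_% 2) (ℕP.+-comm 2 n) ⟩
  (n + 2) % 2              ≡⟨ DivModP.[m+n]%n≡m%n n 2 ⟩
  n % 2                    ≡⟨ %2≡oddᵇ n ⟩
  boolToℕ (oddᵇ n)         ≡⟨ cong boolToℕ (BoolP.not-involutive (oddᵇ n)) ⟨
  boolToℕ (oddᵇ (2 + n))   ∎
  where open ≡-Reasoning

odd-suc⇔ : ∀ n → Odd (suc n) ⇔ oddᵇ n ≡ false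
odd-suc⇔ n = mk⇔ (λ odd → not≡1 (sym (%2≡oddᵇ (suc n)) ⟨ trans ⟩ odd))
                 (λ even → %2≡oddᵇ (suc n) ⟨ trans ⟩ cong (boolToℕ ∘ not) even)
  where
  not≡1 : ∀ {b} → boolToℕ (not b) ≡ 1 → b ≡ false
  not≡1 {false} _ = refl

xor-move : ∀ b x y → b xor x ≡ y → x ≡ b xor y
xor-move false x     y    eq   = eq
xor-move true  false true refl = refl
xor-move true  true  false refl = refl

HasParities : (Fin m → Bool) → Vec (Fin m) k → Set
HasParities p v = ∀ x → oddᵇ (occ x v) ≡ p x

hasParities? : (p : Fin m → Bool) → Decidable (HasParities {k = k} p)
hasParities? p v = FinP.all? (λ x → oddᵇ (occ x v) BoolP.≟ p x)

toggle : Fin m → (Fin m → Bool) → (Fin m → Bool)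
toggle x p y = does (y ≟ x) xor p y

HasParities-∷ : (p : Fin m → Bool) (x : Fin m) → (λ v → HasParities p (x ∷ v)) ≐ HasParities {k = k} (toggle x p)
HasParities-∷ p x =
  (λ {v} hp y → xor-move (does (y ≟ x)) _ _ (sym (oddᵇ-δ+ (does (y ≟ x)) (occ y v)) ⟨ trans ⟩ hp y)) ,
  (λ {v} hp y → oddᵇ-δ+ (does (y ≟ x)) (occ y v) ⟨ trans ⟩ sym (xor-move (does (y ≟ x)) (p y) _ (sym (hp y))))
  where
  oddᵇ-δ+ : ∀ b n → oddᵇ (boolToℕ b + n) ≡ b xor oddᵇ n
  oddᵇ-δ+ true  n = refl
  oddᵇ-δ+ false n = refl

#withParities : (Fin m → Bool) → ℕ → ℕ
#withParities {m} p k = length (filter (hasParities? p) (words m k))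

#withParities-suc : (p : Fin m → Bool) (k : ℕ) →
                    #withParities p (suc k) ≡ ℕΣ.sum (λ x → #withParities (toggle x p) k)
#withParities-suc {m} p k =
  length-filter-cartesianProductWith (hasParities? p) _∷_ id (words m k) ⟨ trans ⟩
  ℕΣ.sum-cong-≗ (λ x → cong length (ListP.filter-≐ _ (hasParities? (toggle x p)) (HasParities-∷ p x) (words m k)))

#withParities-zero-even : {p : Fin m → Bool} → (∀ x → p x ≡ false) → #withParities p 0 ≡ 1
#withParities-zero-even {p = p} p≡false = cong length (ListP.filter-accept (hasParities? p) (sym ∘ p≡false))

#withParities-zero-odd : {p : Fin m → Bool} {x : Fin m} → p x ≡ true → #withParities p 0 ≡ 0
#withParities-zero-odd {p = p} {x} px≡true =
  cong length (ListP.filter-reject (hasParities? p) (λ hp → case trans (hp x) px≡true of λ ()))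

AllEven : Vec (Fin m) k → Set
AllEven = HasParities (λ _ → false)

evenWords : ∀ m k → List (Vec (Fin m) k)
evenWords m k = filter (hasParities? (λ _ → false)) (words m k)

-- Character sums over sign vectors

sign : Bool → ℤ
sign true  = + 1
sign false = ℤ.-1ℤ

signSum : Vec Bool m → ℤ
signSum []      = + 0
signSum (b ∷ s) = sign b ℤ.+ signSum s

∑± : ∀ m → (Vec Bool m → ℤ) → ℤ
∑± zero    F = F []
∑± (suc m) F = ∑± m (F ∘ (true ∷_)) ℤ.+ ∑± m (F ∘ (false ∷_))

∑±-cong : {F G : Vec Bool m → ℤ} → (∀ s → F s ≡ G s) → ∑± m F ≡ ∑± m G
∑±-cong {zero}  F≗G = F≗G []
∑±-cong {suc m} F≗G = cong₂ ℤ._+_ (∑±-cong (F≗G ∘ (true ∷_))) (∑±-cong (F≗G ∘ (false ∷_)))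

∑±-distrib-+ : (F G : Vec Bool m → ℤ) → ∑± m (λ s → F s ℤ.+ G s) ≡ ∑± m F ℤ.+ ∑± m G
∑±-distrib-+ {zero}  F G = refl
∑±-distrib-+ {suc m} F G =
  cong₂ ℤ._+_ (∑±-distrib-+ (F ∘ (true ∷_)) (G ∘ (true ∷_)))
              (∑±-distrib-+ (F ∘ (false ∷_)) (G ∘ (false ∷_))) ⟨ trans ⟩
  ℤ+-interchange (∑± m (F ∘ (true ∷_))) (∑± m (G ∘ (true ∷_)))
                 (∑± m (F ∘ (false ∷_))) (∑± m (G ∘ (false ∷_)))

∑±-*ˡ : (c : ℤ) (F : Vec Bool m → ℤ) → ∑± m (λ s → c * F s) ≡ c * ∑± m F
∑±-*ˡ {zero}  c F = refl
∑±-*ˡ {suc m} c F =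
  cong₂ ℤ._+_ (∑±-*ˡ c (F ∘ (true ∷_))) (∑±-*ˡ c (F ∘ (false ∷_))) ⟨ trans ⟩ sym (ℤP.*-distribˡ-+ c _ _)

∑±-∑-comm : (G : Fin n → Vec Bool m → ℤ) →
            ∑± m (λ s → ℤΣ.sum (λ x → G x s)) ≡ ℤΣ.sum (λ x → ∑± m (G x))
∑±-∑-comm {m = zero}  G = refl
∑±-∑-comm {m = suc m} G =
  cong₂ ℤ._+_ (∑±-∑-comm (λ x → G x ∘ (true ∷_))) (∑±-∑-comm (λ x → G x ∘ (false ∷_))) ⟨ trans ⟩
  sym (ℤΣ.∑-distrib-+ (λ x → ∑± m (G x ∘ (true ∷_))) (λ x → ∑± m (G x ∘ (false ∷_))))

∑±-const : ∀ m → ∑± m (λ _ → + 1) ≡ (+ 2) ^ m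
∑±-const zero    = refl
∑±-const (suc m) = cong₂ ℤ._+_ (∑±-const m) (∑±-const m) ⟨ trans ⟩ x+x≡2x ((+ 2) ^ m)
  where
  x+x≡2x : ∀ x → x ℤ.+ x ≡ + 2 * x
  x+x≡2x = solve-∀

binomialTerm : ℕ → (ℤ → ℤ) → ℕ → ℤ
binomialTerm m h i = + (m C i) * h (+ (2 ℕ.* i) ℤ.- + m)

binomialSum : ℕ → (ℤ → ℤ) → ℤ
binomialSum m h = ℤΣ.sum {suc m} (binomialTerm m h ∘ toℕ)

binomSum≡binomialSum : ∀ m e → binomSum m e ≡ binomialSum m (_^ e)
binomSum≡binomialSum m e =
  cong sumℤ (ListP.map-upTo (binomialTerm m (_^ e)) (suc m)) ⟨ trans ⟩ sumℤ-applyUpTo (binomialTerm m (_^ e)) (suc m)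
  where
  sumℤ-applyUpTo : (f : ℕ → ℤ) (n : ℕ) → sumℤ (List.applyUpTo f n) ≡ ℤΣ.sum {n} (f ∘ toℕ)
  sumℤ-applyUpTo f zero    = refl
  sumℤ-applyUpTo f (suc n) = cong (λ z → f 0 ℤ.+ z) (sumℤ-applyUpTo (f ∘ suc) n)

sum-toℕ-last : (g : ℕ → ℤ) → ℤΣ.sum {suc n} (g ∘ toℕ) ≡ ℤΣ.sum {n} (g ∘ toℕ) ℤ.+ g n
sum-toℕ-last {n} g = ℤΣ.sum-init-last {n} (g ∘ toℕ) ⟨ trans ⟩
  cong₂ ℤ._+_ (ℤΣ.sum-cong-≗ {n} (cong g ∘ FinP.toℕ-inject₁)) (cong g (FinP.toℕ-fromℕ n))

module _ (m : ℕ) (h : ℤ → ℤ) where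

  private
    h₊ h₋ : ℤ → ℤ
    h₊ z = h (+ 1 ℤ.+ z)
    h₋ z = h (ℤ.-1ℤ ℤ.+ z)

    shift₋ : ∀ x → x ℤ.- + suc m ≡ ℤ.-1ℤ ℤ.+ (x ℤ.- + m)
    shift₋ x = lemma x (+ m)
      where
      lemma : ∀ X M → X ℤ.- (+ 1 ℤ.+ M) ≡ ℤ.-1ℤ ℤ.+ (X ℤ.- M)
      lemma = solve-∀

    shift₊ : ∀ i → + (2 ℕ.* suc i) ℤ.- + suc m ≡ + 1 ℤ.+ (+ (2 ℕ.* i) ℤ.- + m)
    shift₊ i rewrite ℤP.pos-* 2 (suc i) | ℤP.pos-* 2 i = lemma (+ i) (+ m)
      where
      lemma : ∀ I M → + 2 * (+ 1 ℤ.+ I) ℤ.- (+ 1 ℤ.+ M) ≡ + 1 ℤ.+ (+ 2 * I ℤ.- M)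
      lemma = solve-∀

  binomialTerm-zero : binomialTerm (suc m) h 0 ≡ binomialTerm m h₋ 0
  binomialTerm-zero = cong (λ z → + 1 * h z) (shift₋ (+ 0))

  binomialTerm-suc : ∀ i → binomialTerm (suc m) h (suc i) ≡ binomialTerm m h₊ i ℤ.+ binomialTerm m h₋ (suc i)
  binomialTerm-suc i = begin
    + (suc m C suc i) * h E
      ≡⟨ cong (λ c → + c * h E) (sym (nCk+nC[k+1]≡[n+1]C[k+1] m i)) ⟩
    + (m C i ℕ.+ m C suc i) * h E
      ≡⟨ cong (_* h E) (ℤP.pos-+ (m C i) (m C suc i)) ⟩
    (+ (m C i) ℤ.+ + (m C suc i)) * h E
      ≡⟨ ℤP.*-distribʳ-+ (h E) (+ (m C i)) (+ (m C suc i)) ⟩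
    + (m C i) * h E ℤ.+ + (m C suc i) * h E
      ≡⟨ cong₂ (λ x y → + (m C i) * h x ℤ.+ + (m C suc i) * h y) (shift₊ i) (shift₋ (+ (2 ℕ.* suc i))) ⟩
    binomialTerm m h₊ i ℤ.+ binomialTerm m h₋ (suc i) ∎
    where
    open ≡-Reasoning
    E = + (2 ℕ.* suc i) ℤ.- + suc m

  binomialSum-suc : binomialSum (suc m) h ≡ binomialSum m h₊ ℤ.+ binomialSum m h₋
  binomialSum-suc = begin
    binomialTerm (suc m) h 0 ℤ.+ ℤΣ.sum {suc m} (binomialTerm (suc m) h ∘ suc ∘ toℕ)
      ≡⟨ cong₂ ℤ._+_ binomialTerm-zero
               (ℤΣ.sum-cong-≗ {suc m} (binomialTerm-suc ∘ toℕ) ⟨ trans ⟩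
                ℤΣ.∑-distrib-+ {suc m} (binomialTerm m h₊ ∘ toℕ) (B₋ ∘ suc ∘ toℕ)) ⟩
    B₋ 0 ℤ.+ (binomialSum m h₊ ℤ.+ ℤΣ.sum {suc m} (B₋ ∘ suc ∘ toℕ))
      ≡⟨ cong (λ z → B₋ 0 ℤ.+ (binomialSum m h₊ ℤ.+ z)) (sum-toℕ-last {m} (B₋ ∘ suc) ⟨ trans ⟩ drop-last) ⟩
    B₋ 0 ℤ.+ (binomialSum m h₊ ℤ.+ ℤΣ.sum {m} (B₋ ∘ suc ∘ toℕ))
      ≡⟨ ℤ+-x∙yz≈y∙xz (B₋ 0) (binomialSum m h₊) _ ⟩
    binomialSum m h₊ ℤ.+ binomialSum m h₋ ∎
    where
    open ≡-Reasoning
    B₋ = binomialTerm m h₋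
    drop-last : ℤΣ.sum {m} (B₋ ∘ suc ∘ toℕ) ℤ.+ B₋ (suc m) ≡ ℤΣ.sum {m} (B₋ ∘ suc ∘ toℕ)
    drop-last = cong (λ c → S ℤ.+ + c * H) (k>n⇒nCk≡0 (ℕP.n<1+n m)) ⟨ trans ⟩
                cong (λ z → S ℤ.+ z) (ℤP.*-zeroˡ H) ⟨ trans ⟩ ℤP.+-identityʳ S
      where
      S = ℤΣ.sum {m} (B₋ ∘ suc ∘ toℕ)
      H = h₋ (+ (2 ℕ.* suc m) ℤ.- + m)

∑±-signSum : ∀ m (h : ℤ → ℤ) → ∑± m (h ∘ signSum) ≡ binomialSum m h
∑±-signSum zero    h = sym (ℤP.+-identityʳ _ ⟨ trans ⟩ ℤP.*-identityˡ _)
∑±-signSum (suc m) h =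
  cong₂ ℤ._+_ (∑±-signSum m (λ z → h (+ 1 ℤ.+ z))) (∑±-signSum m (λ z → h (ℤ.-1ℤ ℤ.+ z))) ⟨ trans ⟩
  sym (binomialSum-suc m h)

-- The character of (ℤ/2)^m indexed by p, evaluated at the sign vector s: χ p s = ∏_{p x} sign (s x).
χ : (Fin m → Bool) → Vec Bool m → ℤ
χ p []      = + 1
χ p (b ∷ s) = (if p zero then sign b else + 1) * χ (p ∘ suc) s

χ-trivial : {p : Fin m → Bool} → (∀ x → p x ≡ false) → (s : Vec Bool m) → χ p s ≡ + 1
χ-trivial p≡false []      = refl
χ-trivial p≡false (b ∷ s) rewrite p≡false zero = ℤP.*-identityˡ _ ⟨ trans ⟩ χ-trivial (p≡false ∘ suc) s

∑±-χ-trivial : {p : Fin m → Bool} → (∀ x → p x ≡ false) → ∑± m (χ p) ≡ (+ 2) ^ m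
∑±-χ-trivial {m} p≡false = ∑±-cong (χ-trivial p≡false) ⟨ trans ⟩ ∑±-const m

∑±-χ-nontrivial : {p : Fin m → Bool} {x : Fin m} → p x ≡ true → ∑± m (χ p) ≡ + 0
∑±-χ-nontrivial {suc m} {p} {x} px≡true = begin
  ∑± m (λ s → c true * χ (p ∘ suc) s) ℤ.+ ∑± m (λ s → c false * χ (p ∘ suc) s)
    ≡⟨ cong₂ ℤ._+_ (∑±-*ˡ (c true) (χ (p ∘ suc))) (∑±-*ˡ (c false) (χ (p ∘ suc))) ⟩
  c true * ∑± m (χ (p ∘ suc)) ℤ.+ c false * ∑± m (χ (p ∘ suc))
    ≡⟨ cancel x px≡true ⟩
  + 0 ∎
  where
  open ≡-Reasoning
  c : Bool → ℤ
  c b = if p zero then sign b else + 1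
  cancel : ∀ x → p x ≡ true → c true * ∑± m (χ (p ∘ suc)) ℤ.+ c false * ∑± m (χ (p ∘ suc)) ≡ + 0
  cancel zero    p₀≡true rewrite p₀≡true = lemma (∑± m (χ (p ∘ suc)))
    where
    lemma : ∀ S → + 1 * S ℤ.+ ℤ.-1ℤ * S ≡ + 0
    lemma = solve-∀
  cancel (suc x) px≡true rewrite ∑±-χ-nontrivial {p = p ∘ suc} px≡true =
    cong₂ ℤ._+_ (ℤP.*-zeroʳ (c true)) (ℤP.*-zeroʳ (c false))

signSum*χ : (p : Fin m → Bool) (s : Vec Bool m) → signSum s * χ p s ≡ ℤΣ.sum (λ x → χ (toggle x p) s)
signSum*χ p []      = refl
signSum*χ p (b ∷ s) = begin
  (sign b ℤ.+ signSum s) * (c * χ (p ∘ suc) s)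
    ≡⟨ distrib (sign b) (signSum s) c (χ (p ∘ suc) s) ⟩
  (sign b * c) * χ (p ∘ suc) s ℤ.+ c * (signSum s * χ (p ∘ suc) s)
    ≡⟨ cong₂ (λ x y → x * χ (p ∘ suc) s ℤ.+ c * y) (sign*sign-or-1 (p zero) b) (signSum*χ (p ∘ suc) s) ⟩
  χ (toggle zero p) (b ∷ s) ℤ.+ c * ℤΣ.sum (λ x → χ (toggle x (p ∘ suc)) s)
    ≡⟨ cong (λ z → χ (toggle zero p) (b ∷ s) ℤ.+ z)
            (ℤΣ.*-distribˡ-sum c (λ x → χ (toggle x (p ∘ suc)) s)) ⟩
  ℤΣ.sum (λ x → χ (toggle x p) (b ∷ s)) ∎
  where
  open ≡-Reasoning
  c = if p zero then sign b else + 1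
  distrib : ∀ a σ c X → (a ℤ.+ σ) * (c * X) ≡ (a * c) * X ℤ.+ c * (σ * X)
  distrib = solve-∀
  sign*sign-or-1 : ∀ q b → sign b * (if q then sign b else + 1) ≡ (if not q then sign b else + 1)
  sign*sign-or-1 true  true  = refl
  sign*sign-or-1 true  false = refl
  sign*sign-or-1 false true  = refl
  sign*sign-or-1 false false = refl

pos-sum : (f : Fin n → ℕ) → + ℕΣ.sum f ≡ ℤΣ.sum (λ x → + f x)
pos-sum {zero}  f = refl
pos-sum {suc n} f = ℤP.pos-+ (f zero) (ℕΣ.sum (f ∘ suc)) ⟨ trans ⟩ cong (λ z → + f zero ℤ.+ z) (pos-sum (f ∘ suc))

∑±-signSum^k-χ : ∀ m k (p : Fin m → Bool) →
                 ∑± m (λ s → signSum s ^ k * χ p s) ≡ (+ 2) ^ m * + #withParities p k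
∑±-signSum^k-χ m zero p = ∑±-cong {m} (λ s → ℤP.*-identityˡ (χ p s)) ⟨ trans ⟩ trivial-or-not
  where
  trivial-or-not : ∑± m (χ p) ≡ (+ 2) ^ m * + #withParities p 0
  trivial-or-not with FinP.any? (λ x → p x BoolP.≟ true)
  ... | yes (x , px≡true) = ∑±-χ-nontrivial {p = p} px≡true ⟨ trans ⟩
    sym (cong (λ c → (+ 2) ^ m * + c) (#withParities-zero-odd {p = p} px≡true) ⟨ trans ⟩ ℤP.*-zeroʳ ((+ 2) ^ m))
  ... | no  ¬px≡true      = ∑±-χ-trivial {p = p} p≡false ⟨ trans ⟩
    sym (cong (λ c → (+ 2) ^ m * + c) (#withParities-zero-even {p = p} p≡false) ⟨ trans ⟩
         ℤP.*-identityʳ ((+ 2) ^ m))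
    where
    p≡false : ∀ x → p x ≡ false
    p≡false x = BoolP.¬-not (¬px≡true ∘ (x ,_))
∑±-signSum^k-χ m (suc k) p = begin
  ∑± m (λ s → signSum s ^ suc k * χ p s)
    ≡⟨ ∑±-cong {m} (λ s → reassoc (signSum s) (signSum s ^ k) (χ p s)) ⟩
  ∑± m (λ s → signSum s ^ k * (signSum s * χ p s))
    ≡⟨ ∑±-cong {m} (λ s → cong (signSum s ^ k *_) (signSum*χ p s) ⟨ trans ⟩
                          ℤΣ.*-distribˡ-sum (signSum s ^ k) (λ x → χ (toggle x p) s)) ⟩
  ∑± m (λ s → ℤΣ.sum (λ x → signSum s ^ k * χ (toggle x p) s))
    ≡⟨ ∑±-∑-comm (λ x s → signSum s ^ k * χ (toggle x p) s) ⟩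
  ℤΣ.sum (λ x → ∑± m (λ s → signSum s ^ k * χ (toggle x p) s))
    ≡⟨ ℤΣ.sum-cong-≗ {m} (λ x → ∑±-signSum^k-χ m k (toggle x p)) ⟩
  ℤΣ.sum (λ x → (+ 2) ^ m * + #withParities (toggle x p) k)
    ≡⟨ ℤΣ.*-distribˡ-sum ((+ 2) ^ m) (λ x → + #withParities (toggle x p) k) ⟨
  (+ 2) ^ m * ℤΣ.sum (λ x → + #withParities (toggle x p) k)
    ≡⟨ cong ((+ 2) ^ m *_) (sym (pos-sum (λ x → #withParities (toggle x p) k)) ⟨ trans ⟩
                            cong +_ (sym (#withParities-suc p k))) ⟩
  (+ 2) ^ m * + #withParities p (suc k) ∎
  where
  open ≡-Reasoning
  reassoc : ∀ σ P X → (σ * P) * X ≡ P * (σ * X)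
  reassoc = solve-∀

binomSum≡2^m*#evenWords : ∀ m k → binomSum m k ≡ (+ 2) ^ m * + length (evenWords m k)
binomSum≡2^m*#evenWords m k = begin
  binomSum m k                                            ≡⟨ binomSum≡binomialSum m k ⟩
  binomialSum m (_^ k)                                    ≡⟨ ∑±-signSum m (_^ k) ⟨
  ∑± m (λ s → signSum s ^ k)
    ≡⟨ ∑±-cong {m} (λ s → sym (ℤP.*-identityʳ _) ⟨ trans ⟩ cong (signSum s ^ k *_) (sym (χ-trivial (λ _ → refl) s))) ⟩
  ∑± m (λ s → signSum s ^ k * χ (λ _ → false) s)           ≡⟨ ∑±-signSum^k-χ m k (λ _ → false) ⟩
  (+ 2) ^ m * + length (evenWords m k)                    ∎
  where open ≡-Reasoning

length-cartesianProduct : {A B : Set} (xs : List A) (ys : List B) →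
                          length (List.cartesianProduct xs ys) ≡ length xs ℕ.* length ys
length-cartesianProduct []       ys = refl
length-cartesianProduct (x ∷ xs) ys =
  ListP.length-++ (List.map (x ,_) ys) ⟨ trans ⟩ cong₂ _+_ (ListP.length-map (x ,_) ys) (length-cartesianProduct xs ys)

odd-degrees⇔even-code : {f : Vec (Fin m) k} {g : Vec (Fin n) l} {T : Subgraph m n} →
                        DegreeCode f g T → (∀ v → Odd (degree T v)) ⇔ (AllEven f × AllEven g)
odd-degrees⇔even-code {f = f} {g} (degrees left right) = mk⇔
  (λ odd → (λ x → Equivalence.to (odd-suc⇔ (occ x f)) (subst Odd (left x) (odd (inj₁ x)))) ,
           (λ y → Equivalence.to (odd-suc⇔ (occ y g)) (subst Odd (right y) (odd (inj₂ y)))))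
  (λ { (even-f , even-g) (inj₁ x) → subst Odd (sym (left x)) (Equivalence.from (odd-suc⇔ (occ x f)) (even-f x))
     ; (even-f , even-g) (inj₂ y) → subst Odd (sym (right y)) (Equivalence.from (odd-suc⇔ (occ y g)) (even-g y)) })

oddTrees : ∀ a b → List (Subgraph (suc a) (suc b))
oddTrees a b = List.map (decode a b) (List.cartesianProduct (evenWords (suc a) b) (evenWords (suc b) a))

oddTrees-unique : ∀ a b → Unique (oddTrees a b)
oddTrees-unique a b = UniqueP.map⁺ (decode-injective a b _ _)
  (UniqueP.cartesianProduct⁺ (UniqueP.filter⁺ _ (words-unique (suc a) b)) (UniqueP.filter⁺ _ (words-unique (suc b) a)))

∈-oddTrees⇔ : ∀ a b (S : Subgraph (suc a) (suc b)) → S ∈ oddTrees a b ⇔ IsOddSpanningTree S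
∈-oddTrees⇔ a b S = mk⇔ to from
  where
  even? : ∀ {m k} → Decidable (AllEven {m} {k})
  even? = hasParities? (λ _ → false)
  to : S ∈ oddTrees a b → IsOddSpanningTree S
  to S∈ with (f , g) , fg∈ , refl ← ∈-map⁻ (decode a b) S∈
    with f∈ , g∈ ← ∈-cartesianProduct⁻ (evenWords (suc a) b) (evenWords (suc b) a) fg∈
    with tree , code ← decode-sound a b (f , g) =
    tree , Equivalence.from (odd-degrees⇔even-code code)
                            (proj₂ (∈-filter⁻ even? {xs = words (suc a) b} f∈) , proj₂ (∈-filter⁻ even? {xs = words (suc b) a} g∈))
  from : IsOddSpanningTree S → S ∈ oddTrees a b
  from (tree , odd) with (f , g) , refl ← decode-surjective a b S tree
    with even-f , even-g ← Equivalence.to (odd-degrees⇔even-code (proj₂ (decode-sound a b (f , g)))) odd =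
    ∈-map⁺ (decode a b)
      (∈-cartesianProduct⁺ (∈-filter⁺ even? (∈-words f) even-f) (∈-filter⁺ even? (∈-words g) even-g))

length-oddTrees : ∀ a b → length (oddTrees a b) ≡ length (evenWords (suc a) b) ℕ.* length (evenWords (suc b) a)
length-oddTrees a b =
  ListP.length-map (decode a b) (List.cartesianProduct (evenWords (suc a) b) (evenWords (suc b) a)) ⟨ trans ⟩
  length-cartesianProduct (evenWords (suc a) b) (evenWords (suc b) a)

theorem4p1 : (m n : ℕ) → 1 ≤ m → 1 ≤ n →
    Σ (List (Subgraph m n)) λ L →
      Unique L × (∀ S → (S ∈ L) ⇔ IsOddSpanningTree S) ×
      ((+ 2) ^ (m + n) * + (length L) ≡ binomSum m (n ∸ 1) * binomSum n (m ∸ 1))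
theorem4p1 (suc a) (suc b) _ _ = oddTrees a b , oddTrees-unique a b , ∈-oddTrees⇔ a b , count
  where
  open ≡-Reasoning
  N₁ = length (evenWords (suc a) b)
  N₂ = length (evenWords (suc b) a)
  count : (+ 2) ^ (suc a + suc b) * + length (oddTrees a b) ≡ binomSum (suc a) b * binomSum (suc b) a
  count = begin
    (+ 2) ^ (suc a + suc b) * + length (oddTrees a b)
      ≡⟨ cong₂ _*_ (ℤP.^-distribˡ-+-* (+ 2) (suc a) (suc b))
                   (cong +_ (length-oddTrees a b) ⟨ trans ⟩ ℤP.pos-* N₁ N₂) ⟩
    ((+ 2) ^ suc a * (+ 2) ^ suc b) * (+ N₁ * + N₂)
      ≡⟨ interchange ((+ 2) ^ suc a) ((+ 2) ^ suc b) (+ N₁) (+ N₂) ⟩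
    ((+ 2) ^ suc a * + N₁) * ((+ 2) ^ suc b * + N₂)
      ≡⟨ cong₂ _*_ (binomSum≡2^m*#evenWords (suc a) b) (binomSum≡2^m*#evenWords (suc b) a) ⟨
    binomSum (suc a) b * binomSum (suc b) a ∎
    where
    interchange : ∀ P Q F G → (P * Q) * (F * G) ≡ (P * F) * (Q * G)
    interchange = solve-∀
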